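{- Let $D>1$ be squarefree, $\mathcal{O}$ the ring of integers of $\mathbb{Q}(\sqrt D)$, $\Gamma_{\mathcal O}=\mathrm{PSL}_2(\mathcal{O})$ and $\Gamma=M/\{\pm\mathrm{Id}\}$ with $M=\{\begin{pmatrix}a&b\\c&d\end{pmatrix}\in\mathrm{SL}_2(\mathcal{O}):a+d,\ b+c\in2\mathcal{O}\}$. Define $T_u=\begin{pmatrix}1&u\\0&1\end{pmatrix}$, $S=\begin{pmatrix}0&1\\-1&0\end{pmatrix}$, $\omega=\frac{1+\sqrt D}{2}$, $\overline\omega=\frac{1-\sqrt D}{2}$, $\eta=1+\sqrt D$ if $D\equiv3\pmod4$ and $\eta=\sqrt D$ if $D\equiv2\pmod4$, $\Omega=\{1,\omega,\overline\omega\}$, $\Omega^*=\{\omega,\overline\omega\}$, and \[ C_1=\{\mathrm{Id}\}\cup\{T_u\}_{u\in\Omega},\quad C_2=\{ST_u\}_{u\in\Omega},\quad C_3=\{T_uST_v\}_{u\in\Omega,\,v\in\Omega^*},\quad C_4=\{ST_vST_v\}_{v\in\Omega^*}. \] Then a complete set of representatives of the left cosets $\Gamma_{\mathcal O}/\Gamma$ is given by \[ \mathcal{R}_D=\begin{cases}\{\mathrm{Id},T_1,T_\eta,T_{\eta+1},ST_1,ST_{\eta+1}\}&\text{if }4\nmid D-1,\\ C_1\cup C_2\cup\{T_1ST_\omega,T_1ST_{\overline\omega}\}&\text{if }8\mid D-1,\\ C_1\cup C_2\cup C_3\cup C_4&\text{if }8\mid D-5.\end{cases} \]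
   Context: Here the Hilbert modular group $\{(\gamma,\gamma^\sigma):\gamma\in\mathrm{PSL}_2(\mathcal{O})\}$ and its subgroup $\{(\gamma,\gamma^\sigma):\gamma\in M/\{\pm\mathrm{Id}\}\}$ are identified, as abstract groups, with $\mathrm{PSL}_2(\mathcal{O})$ and $M/\{\pm \mathrm{Id}\}$ by dropping the conjugate component. $\mathcal{O}=\mathbb{Z}[\sqrt D]$ if $D\not\equiv1\pmod4$ and $\mathbb{Z}[\omega]$ otherwise. Two elements $g_1,g_2$ lie in the same left coset iff $g_2^{ -1}g_1\in\Gamma$. -}

module Defs where

open import Data.Bool using (Bool; if_then_else_)
open import Data.Nat as ℕ using (ℕ; _≡ᵇ_)
open import Data.Integer as ℤ using (ℤ; +_; -_; _+_; _*_; _-_)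
open import Data.Integer.Divisibility as ℤDiv using ()
open import Data.Nat.Divisibility as ℕDiv using ()
open import Data.Product using (_×_; _,_; ∃-syntax)
open import Data.Sum using (_⊎_)
open import Data.List using (List; []; _∷_; _++_; length; lookup)
open import Data.List.Relation.Unary.All using (All)
open import Data.Fin using (Fin)
open import Relation.Binary.PropositionalEquality using (_≡_)

Squarefree : ℕ → Set
Squarefree D = ∀ (n : ℕ) → (n ℕ.* n) ℕDiv.∣ D → n ≡ 1

-- An element (x , y) : 𝒪 stands for x + y·θ, where
--   θ = ω = (1+√D)/2   if D ≡ 1 (mod 4)   (so θ² = (D-1)/4 + θ),
--   θ = √D             otherwise           (so θ² = D).
-- {1, θ} is a ℤ-basis of 𝒪, so equality in 𝒪 is equality of pairs.

𝒪 : Set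
𝒪 = ℤ × ℤ

-- θ² = p D + q D · θ
p : ℕ → ℤ
p D = if (D ℕ.% 4) ≡ᵇ 1 then + ((D ℕ.∸ 1) ℕ./ 4) else + D

q : ℕ → ℤ
q D = if (D ℕ.% 4) ≡ᵇ 1 then + 1 else + 0

_⊕_ : 𝒪 → 𝒪 → 𝒪
(a , b) ⊕ (c , d) = (a + c , b + d)

⊝_ : 𝒪 → 𝒪
⊝ (a , b) = (- a , - b)

mul : ℕ → 𝒪 → 𝒪 → 𝒪
mul D (a , b) (c , d) = (a * c + b * d * p D , a * d + b * c + b * d * q D)

𝟘 𝟙 θ : 𝒪
𝟘 = (+ 0 , + 0)
𝟙 = (+ 1 , + 0)
θ = (+ 0 , + 1)

In2𝒪 : 𝒪 → Set
In2𝒪 (x , y) = (+ 2 ℤDiv.∣ x) × (+ 2 ℤDiv.∣ y)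

record Mat : Set where
  constructor mat
  field
    a b c d : 𝒪

open Mat public

mmul : ℕ → Mat → Mat → Mat
mmul D (mat a₁ b₁ c₁ d₁) (mat a₂ b₂ c₂ d₂) =
  mat (mul D a₁ a₂ ⊕ mul D b₁ c₂) (mul D a₁ b₂ ⊕ mul D b₁ d₂)
      (mul D c₁ a₂ ⊕ mul D d₁ c₂) (mul D c₁ b₂ ⊕ mul D d₁ d₂)

mneg : Mat → Mat
mneg (mat a b c d) = mat (⊝ a) (⊝ b) (⊝ c) (⊝ d)

det : ℕ → Mat → 𝒪
det D (mat a b c d) = mul D a d ⊕ (⊝ mul D b c)

-- the inverse of a matrix of determinant 1 (its adjugate)
minv : Mat → Mat
minv (mat a b c d) = mat d (⊝ b) (⊝ c) a

InSL : ℕ → Mat → Set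
InSL D g = det D g ≡ 𝟙

InM : ℕ → Mat → Set
InM D g = InSL D g × In2𝒪 (a g ⊕ d g) × In2𝒪 (b g ⊕ c g)

-- g₁, g₂ ∈ SL₂(𝒪) lie in the same left coset of Γ = M/{±Id} in PSL₂(𝒪):
-- ±(g₂⁻¹ g₁) ∈ M
SameCoset : ℕ → Mat → Mat → Set
SameCoset D g₁ g₂ =
  InM D (mmul D (minv g₂) g₁) ⊎ InM D (mneg (mmul D (minv g₂) g₁))

CompleteReps : ℕ → List Mat → Set
CompleteReps D R =
  All (InSL D) R
  × (∀ (g : Mat) → InSL D g → ∃[ i ] SameCoset D g (lookup R i))
  × (∀ (i j : Fin (length R)) → SameCoset D (lookup R i) (lookup R j) → i ≡ j)

Id S : Mat
Id = mat 𝟙 𝟘 𝟘 𝟙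
S  = mat 𝟘 𝟙 (⊝ 𝟙) 𝟘

T : 𝒪 → Mat
T u = mat 𝟙 u 𝟘 𝟙

-- ω = θ and ω̄ = 1 - ω (when D ≡ 1 mod 4)
ω ω̄ : 𝒪
ω = θ
ω̄ = 𝟙 ⊕ (⊝ θ)

η : ℕ → 𝒪
η D = if (D ℕ.% 4) ≡ᵇ 3 then 𝟙 ⊕ θ else θ

m3 : ℕ → Mat → Mat → Mat → Mat
m3 D x y z = mmul D x (mmul D y z)

m4 : ℕ → Mat → Mat → Mat → Mat → Mat
m4 D x y z w = mmul D x (m3 D y z w)

C₁ : List Mat
C₁ = Id ∷ T 𝟙 ∷ T ω ∷ T ω̄ ∷ []

C₂ : ℕ → List Mat
C₂ D = mmul D S (T 𝟙) ∷ mmul D S (T ω) ∷ mmul D S (T ω̄) ∷ []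

C₃ : ℕ → List Mat
C₃ D = m3 D (T 𝟙) S (T ω) ∷ m3 D (T 𝟙) S (T ω̄)
     ∷ m3 D (T ω) S (T ω) ∷ m3 D (T ω) S (T ω̄)
     ∷ m3 D (T ω̄) S (T ω) ∷ m3 D (T ω̄) S (T ω̄) ∷ []

C₄ : ℕ → List Mat
C₄ D = m4 D S (T ω) S (T ω) ∷ m4 D S (T ω̄) S (T ω̄) ∷ []

R₁ : ℕ → List Mat
R₁ D = Id ∷ T 𝟙 ∷ T (η D) ∷ T (η D ⊕ 𝟙) ∷ mmul D S (T 𝟙) ∷ mmul D S (T (η D ⊕ 𝟙)) ∷ []

R₂ : ℕ → List Mat
R₂ D = C₁ ++ C₂ D ++ (m3 D (T 𝟙) S (T ω) ∷ m3 D (T 𝟙) S (T ω̄) ∷ [])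

R₃ : ℕ → List Mat
R₃ D = C₁ ++ C₂ D ++ C₃ D ++ C₄ D

module Submission where

-- The group M contains every matrix ≡ Id (mod 2𝒪), so whether g₂⁻¹g₁ lies in ±M only
-- depends on g₁ and g₂ modulo 2.  The proof therefore reduces everything modulo 2:
--   * reduction ℤ → ℤ/2 (represented by Bool) is a ring homomorphism, hence so is
--     𝒪 → 𝒪/2𝒪 = 𝔽₂[θ]/(θ² − q̂θ − p̂) and matrix reduction; the ring 𝒪/2𝒪 only
--     depends on the residues p̂, q̂ of the structure constants p D, q D;
--   * M reduces onto Γ̂ = {trace = 0, b + c = 0} in SL₂(𝒪/2𝒪), and for matrices of
--     determinant 1 membership in M is equivalent to membership of the residue in Γ̂
--     (this uses det (AB) = det A det B, a polynomial identity checked by the ring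
--     solver); hence a list R ⊆ SL₂(𝒪) whose residues form a complete set of
--     representatives of SL₂(𝒪/2𝒪)/Γ̂ is complete for PSL₂(𝒪)/Γ (lift-reps);
--   * the latter property is decidable and is verified by evaluation for the four
--     possible rings 𝒪/2𝒪 (D ≡ 1, 5 mod 8 and D ≡ 2, 3 mod 4);
--   * finally the hypotheses of the proposition determine the class of D.

open import Defs
open import Data.Nat using (ℕ; _<_)
open import Data.Integer using (+_; _-_)
open import Data.Integer.Divisibility using (_∣_)
open import Data.Product using (_×_)
open import Relation.Nullary using (¬_)

open import Data.Bool using (Bool; true; false; _xor_; _∧_)
open import Data.Bool.Properties using () renaming (_≟_ to _≟ᵇ_)
open import Data.Nat as ℕ using (suc; s≤s)
import Data.Nat.Properties as ℕ
open import Data.Nat.Divisibility as ℕ∣ using (∣⇒≤)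
open import Data.Nat.DivMod using (m≡m%n+[m/n]*n; m%n<n; [m+kn]%n≡m%n; m*n/n≡m)
open import Data.Integer as ℤ using (ℤ; -_; _+_; _*_)
import Data.Integer.Properties as ℤ
open import Data.Integer.DivMod using (a≡a%ℕn+[a/ℕn]*n; n%ℕd<d)
open import Data.Integer.Divisibility.Signed as Signed
  using (divides; ∣m∣n⇒∣m+n; ∣m⇒∣m*n; ∣n⇒∣m*n; ∣m⇒∣-m; ∣ᵤ⇒∣; ∣⇒∣ᵤ)
open import Data.Integer.Tactic.RingSolver using (solve-∀; ring)
open import Tactic.RingSolver.NonReflective ring
  using (Expr; solve; _⊜_) renaming (_⊕_ to _:+_; _⊗_ to _:*_; ⊝_ to :-_)
open import Data.Empty using (⊥-elim)
open import Data.Product using (∃; ∃-syntax; _,_; proj₁; proj₂)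
open import Data.Product.Properties using (≡-dec)
open import Data.Sum using (_⊎_; inj₁; inj₂)
open import Data.Fin as Fin using (Fin; cast)
open import Data.Fin.Properties using (all?; any?; cast-involutive)
open import Data.List using (List; []; _∷_; _++_; length; lookup)
open import Data.List.Relation.Unary.All as All using (All; []; _∷_)
import Data.List.Relation.Unary.All.Properties as All
open import Data.List.Membership.Propositional.Properties using (∈-lookup)
open import Data.List.Relation.Binary.Pointwise
  using (Pointwise; []; _∷_; lookup⁺; Pointwise-length; ++⁺)
open import Function using (_⇔_; mk⇔; Equivalence; _∘_)
open import Relation.Nullary using (Dec; map′; _×-dec_; _→-dec_)
open import Relation.Nullary.Decidable using (from-yes)
open import Relation.Binary.PropositionalEquality

record _≡₂_ (x y : ℤ) : Set where
  constructor 2∣-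
  field 2∣x-y : + 2 Signed.∣ (x - y)

infix 4 _≡₂_

≡₂-intro : ∀ {x r} k → x ≡ r + k * + 2 → x ≡₂ r
≡₂-intro {r = r} k refl = 2∣- (divides k (shift r (k * + 2)))
  where
  shift : ∀ r m → (r + m) - r ≡ m
  shift = solve-∀

≡₂-sym : ∀ {x y} → x ≡₂ y → y ≡₂ x
≡₂-sym {x} {y} (2∣- h) = 2∣- (subst (+ 2 Signed.∣_) (flip x y) (∣m⇒∣-m h))
  where
  flip : ∀ x y → - (x - y) ≡ y - x
  flip = solve-∀

≡₂-trans : ∀ {x y z} → x ≡₂ y → y ≡₂ z → x ≡₂ z
≡₂-trans {x} {y} {z} (2∣- h) (2∣- k) =
  2∣- (subst (+ 2 Signed.∣_) (telescope x y z) (∣m∣n⇒∣m+n h k))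
  where
  telescope : ∀ x y z → (x - y) + (y - z) ≡ x - z
  telescope = solve-∀

≡₂-+ : ∀ {x x′ y y′} → x ≡₂ x′ → y ≡₂ y′ → x + y ≡₂ x′ + y′
≡₂-+ {x} {x′} {y} {y′} (2∣- h) (2∣- k) =
  2∣- (subst (+ 2 Signed.∣_) (regroup x x′ y y′) (∣m∣n⇒∣m+n h k))
  where
  regroup : ∀ x x′ y y′ → (x - x′) + (y - y′) ≡ (x + y) - (x′ + y′)
  regroup = solve-∀

≡₂-* : ∀ {x x′ y y′} → x ≡₂ x′ → y ≡₂ y′ → x * y ≡₂ x′ * y′
≡₂-* {x} {x′} {y} {y′} (2∣- h) (2∣- k) =
  2∣- (subst (+ 2 Signed.∣_) (regroup x x′ y y′) (∣m∣n⇒∣m+n (∣m⇒∣m*n y h) (∣n⇒∣m*n x′ k)))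
  where
  regroup : ∀ x x′ y y′ → (x - x′) * y + x′ * (y - y′) ≡ x * y - x′ * y′
  regroup = solve-∀

≡₂-neg : ∀ {x x′} → x ≡₂ x′ → - x ≡₂ - x′
≡₂-neg {x} {x′} (2∣- h) = 2∣- (subst (+ 2 Signed.∣_) (regroup x x′) (∣m⇒∣-m h))
  where
  regroup : ∀ x x′ → - (x - x′) ≡ - x - - x′
  regroup = solve-∀

⟦_⟧ : Bool → ℤ
⟦ false ⟧ = + 0
⟦ true ⟧ = + 1

⟦⟧-xor : ∀ b c → ⟦ b ⟧ + ⟦ c ⟧ ≡₂ ⟦ b xor c ⟧
⟦⟧-xor false false = 2∣- (divides (+ 0) refl)
⟦⟧-xor false true = 2∣- (divides (+ 0) refl)
⟦⟧-xor true false = 2∣- (divides (+ 0) refl)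
⟦⟧-xor true true = 2∣- (divides (+ 1) refl)

⟦⟧-∧ : ∀ b c → ⟦ b ⟧ * ⟦ c ⟧ ≡ ⟦ b ∧ c ⟧
⟦⟧-∧ false false = refl
⟦⟧-∧ false true = refl
⟦⟧-∧ true false = refl
⟦⟧-∧ true true = refl

⟦⟧-neg : ∀ b → - ⟦ b ⟧ ≡₂ ⟦ b ⟧
⟦⟧-neg false = 2∣- (divides (+ 0) refl)
⟦⟧-neg true = 2∣- (divides (- + 1) refl)

-- 2 does not divide ±1, so distinct residues are incongruent.
⟦⟧-injective : ∀ {b c} → ⟦ b ⟧ ≡₂ ⟦ c ⟧ → b ≡ c
⟦⟧-injective {false} {false} _ = refl
⟦⟧-injective {true} {true} _ = refl
⟦⟧-injective {false} {true} (2∣- 2∣-1) with ∣⇒≤ (∣⇒∣ᵤ 2∣-1)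
... | s≤s ()
⟦⟧-injective {true} {false} (2∣- 2∣1) with ∣⇒≤ (∣⇒∣ᵤ 2∣1)
... | s≤s ()

record _⇝_ (x : ℤ) (b : Bool) : Set where
  constructor ⇝-by
  field congruent : x ≡₂ ⟦ b ⟧

infix 4 _⇝_

⇝-+ : ∀ {x y b c} → x ⇝ b → y ⇝ c → x + y ⇝ b xor c
⇝-+ {b = b} {c} (⇝-by h) (⇝-by k) = ⇝-by (≡₂-trans (≡₂-+ h k) (⟦⟧-xor b c))

⇝-* : ∀ {x y b c} → x ⇝ b → y ⇝ c → x * y ⇝ b ∧ c
⇝-* {b = b} {c} (⇝-by h) (⇝-by k) = ⇝-by (subst (_ ≡₂_) (⟦⟧-∧ b c) (≡₂-* h k))

⇝-neg : ∀ {x b} → x ⇝ b → - x ⇝ b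
⇝-neg {b = b} (⇝-by h) = ⇝-by (≡₂-trans (≡₂-neg h) (⟦⟧-neg b))

⇝-unique : ∀ {x b c} → x ⇝ b → x ⇝ c → b ≡ c
⇝-unique (⇝-by h) (⇝-by k) = ⟦⟧-injective (≡₂-trans (≡₂-sym h) k)

reduce : ∀ x → ∃ (x ⇝_)
reduce x with x ℤ.%ℕ 2 | n%ℕd<d x 2 | a≡a%ℕn+[a/ℕn]*n x 2
... | 0 | _ | x≡2k = false , ⇝-by (≡₂-intro {r = + 0} (x ℤ./ℕ 2) x≡2k)
... | 1 | _ | x≡1+2k = true , ⇝-by (≡₂-intro {r = + 1} (x ℤ./ℕ 2) x≡1+2k)
... | suc (suc _) | s≤s (s≤s ()) | _

⇝-even : ∀ {x} → x ⇝ false ⇔ + 2 ∣ x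
⇝-even {x} = mk⇔ (λ (⇝-by (2∣- h)) → ∣⇒∣ᵤ (subst (+ 2 Signed.∣_) x-0≡x h))
                 (λ h → ⇝-by (2∣- (subst (+ 2 Signed.∣_) (sym x-0≡x) (∣ᵤ⇒∣ h))))
  where
  x-0≡x : x - + 0 ≡ x
  x-0≡x = ℤ.+-identityʳ x

⇝-shift : ∀ r k {b} → + r ⇝ b → + (r ℕ.+ k ℕ.* 2) ⇝ b
⇝-shift r k (⇝-by r≡b) = ⇝-by (≡₂-trans (≡₂-intro (+ k) r+2k) r≡b)
  where
  r+2k : + (r ℕ.+ k ℕ.* 2) ≡ + r + + k * + 2
  r+2k = trans (ℤ.pos-+ r (k ℕ.* 2)) (cong (_+_ (+ r)) (ℤ.pos-* k 2))

⇝-0 : + 0 ⇝ false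
⇝-0 = ⇝-by (2∣- (divides (+ 0) refl))

⇝-1 : + 1 ⇝ true
⇝-1 = ⇝-by (2∣- (divides (+ 0) refl))

⇝-2 : + 2 ⇝ false
⇝-2 = ⇝-by (2∣- (divides (+ 1) refl))

⇝-3 : + 3 ⇝ true
⇝-3 = ⇝-by (2∣- (divides (+ 1) refl))

-- The arithmetic of 𝒪 = ℤ[θ]/(θ² − Qθ − P) and of 2×2 matrices over it, written once
-- over an arbitrary carrier with operations +, *, −.  Over ℤ with (P , Q) = (p D , q D)
-- these are definitionally Defs' mul, mmul, det and minv; over Bool they describe
-- 𝒪/2𝒪; over the ring solver's expressions they produce polynomial identities.
module Formulas {A : Set} (_+_ _*_ : A → A → A) (-_ : A → A) (P Q : A) where

  Elt : Set
  Elt = A × A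

  _⊞_ : Elt → Elt → Elt
  (x , y) ⊞ (x′ , y′) = (x + x′ , y + y′)

  ⊟_ : Elt → Elt
  ⊟ (x , y) = (- x , - y)

  _·_ : Elt → Elt → Elt
  (x , y) · (x′ , y′) = ((x * x′) + ((y * y′) * P) , ((x * y′) + (y * x′)) + ((y * y′) * Q))

  -- a matrix (a b ; c d) as the tuple (a , b , c , d)
  Matrix : Set
  Matrix = Elt × Elt × Elt × Elt

  _⊠_ : Matrix → Matrix → Matrix
  (a , b , c , d) ⊠ (a′ , b′ , c′ , d′) =
    ((a · a′) ⊞ (b · c′)) , ((a · b′) ⊞ (b · d′)) , ((c · a′) ⊞ (d · c′)) , ((c · b′) ⊞ (d · d′))

  Det : Matrix → Elt
  Det (a , b , c , d) = (a · d) ⊞ (⊟ (b · c))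

  Adj : Matrix → Matrix
  Adj (a , b , c , d) = (d , ⊟ b , ⊟ c , a)

module ℤ-Formulas (P Q : ℤ) = Formulas ℤ._+_ ℤ._*_ ℤ.-_ P Q
module Expr-Formulas {n} (P Q : Expr ℤ n) = Formulas _:+_ _:*_ :-_ P Q

det-⊠ : ∀ P Q x₁ y₁ x₂ y₂ x₃ y₃ x₄ y₄ u₁ v₁ u₂ v₂ u₃ v₃ u₄ v₄ →
  let open ℤ-Formulas P Q
      A = (x₁ , y₁) , (x₂ , y₂) , (x₃ , y₃) , (x₄ , y₄)
      B = (u₁ , v₁) , (u₂ , v₂) , (u₃ , v₃) , (u₄ , v₄)
  in Det (A ⊠ B) ≡ Det A · Det B
det-⊠ P Q x₁ y₁ x₂ y₂ x₃ y₃ x₄ y₄ u₁ v₁ u₂ v₂ u₃ v₃ u₄ v₄ =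
  cong₂ _,_ (solve 18 (λ P Q x₁ y₁ x₂ y₂ x₃ y₃ x₄ y₄ u₁ v₁ u₂ v₂ u₃ v₃ u₄ v₄ →
                 let open Expr-Formulas P Q
                     A = (x₁ , y₁) , (x₂ , y₂) , (x₃ , y₃) , (x₄ , y₄)
                     B = (u₁ , v₁) , (u₂ , v₂) , (u₃ , v₃) , (u₄ , v₄)
                 in proj₁ (Det (A ⊠ B)) ⊜ proj₁ (Det A · Det B))
               refl P Q x₁ y₁ x₂ y₂ x₃ y₃ x₄ y₄ u₁ v₁ u₂ v₂ u₃ v₃ u₄ v₄)
            (solve 18 (λ P Q x₁ y₁ x₂ y₂ x₃ y₃ x₄ y₄ u₁ v₁ u₂ v₂ u₃ v₃ u₄ v₄ →
                 let open Expr-Formulas P Q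
                     A = (x₁ , y₁) , (x₂ , y₂) , (x₃ , y₃) , (x₄ , y₄)
                     B = (u₁ , v₁) , (u₂ , v₂) , (u₃ , v₃) , (u₄ , v₄)
                 in proj₂ (Det (A ⊠ B)) ⊜ proj₂ (Det A · Det B))
               refl P Q x₁ y₁ x₂ y₂ x₃ y₃ x₄ y₄ u₁ v₁ u₂ v₂ u₃ v₃ u₄ v₄)

det-Adj : ∀ P Q x₁ y₁ x₂ y₂ x₃ y₃ x₄ y₄ →
  let open ℤ-Formulas P Q
      A = (x₁ , y₁) , (x₂ , y₂) , (x₃ , y₃) , (x₄ , y₄)
  in Det (Adj A) ≡ Det A
det-Adj P Q x₁ y₁ x₂ y₂ x₃ y₃ x₄ y₄ =
  cong₂ _,_ (solve 10 (λ P Q x₁ y₁ x₂ y₂ x₃ y₃ x₄ y₄ →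
                 let open Expr-Formulas P Q
                     A = (x₁ , y₁) , (x₂ , y₂) , (x₃ , y₃) , (x₄ , y₄)
                 in proj₁ (Det (Adj A)) ⊜ proj₁ (Det A))
               refl P Q x₁ y₁ x₂ y₂ x₃ y₃ x₄ y₄)
            (solve 10 (λ P Q x₁ y₁ x₂ y₂ x₃ y₃ x₄ y₄ →
                 let open Expr-Formulas P Q
                     A = (x₁ , y₁) , (x₂ , y₂) , (x₃ , y₃) , (x₄ , y₄)
                 in proj₂ (Det (Adj A)) ⊜ proj₂ (Det A))
               refl P Q x₁ y₁ x₂ y₂ x₃ y₃ x₄ y₄)

module _ (D : ℕ) where

  det-mmul : ∀ g h → det D (mmul D g h) ≡ mul D (det D g) (det D h)
  det-mmul (mat (x₁ , y₁) (x₂ , y₂) (x₃ , y₃) (x₄ , y₄))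
           (mat (u₁ , v₁) (u₂ , v₂) (u₃ , v₃) (u₄ , v₄)) =
    det-⊠ (p D) (q D) x₁ y₁ x₂ y₂ x₃ y₃ x₄ y₄ u₁ v₁ u₂ v₂ u₃ v₃ u₄ v₄

  det-minv : ∀ g → det D (minv g) ≡ det D g
  det-minv (mat (x₁ , y₁) (x₂ , y₂) (x₃ , y₃) (x₄ , y₄)) =
    det-Adj (p D) (q D) x₁ y₁ x₂ y₂ x₃ y₃ x₄ y₄

  SL-mmul : ∀ {g h} → InSL D g → InSL D h → InSL D (mmul D g h)
  SL-mmul {g} {h} det-g det-h = trans (det-mmul g h) (cong₂ (mul D) det-g det-h)

  SL-minv : ∀ {g} → InSL D g → InSL D (minv g)
  SL-minv {g} det-g = trans (det-minv g) det-g

  SL-T : ∀ u → InSL D (T u)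
  SL-T (u₁ , u₂) rewrite ℤ.*-zeroʳ u₁ | ℤ.*-zeroʳ u₂ = refl

  SL-S : InSL D S
  SL-S = refl

  SL-ST : ∀ u → InSL D (mmul D S (T u))
  SL-ST u = SL-mmul {S} {T u} SL-S (SL-T u)

  SL-TST : ∀ u v → InSL D (m3 D (T u) S (T v))
  SL-TST u v = SL-mmul {T u} {mmul D S (T v)} (SL-T u) (SL-ST v)

  SL-STST : ∀ u → InSL D (m4 D S (T u) S (T u))
  SL-STST u = SL-mmul {S} {m3 D (T u) S (T u)} SL-S (SL-TST u u)

  C₁⊆SL : All (InSL D) C₁
  C₁⊆SL = SL-T 𝟘 ∷ SL-T 𝟙 ∷ SL-T ω ∷ SL-T ω̄ ∷ []

  C₂⊆SL : All (InSL D) (C₂ D)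
  C₂⊆SL = SL-ST 𝟙 ∷ SL-ST ω ∷ SL-ST ω̄ ∷ []

  C₃⊆SL : All (InSL D) (C₃ D)
  C₃⊆SL = SL-TST 𝟙 ω ∷ SL-TST 𝟙 ω̄ ∷ SL-TST ω ω ∷ SL-TST ω ω̄ ∷ SL-TST ω̄ ω ∷ SL-TST ω̄ ω̄ ∷ []

  C₄⊆SL : All (InSL D) (C₄ D)
  C₄⊆SL = SL-STST ω ∷ SL-STST ω̄ ∷ []

  R₁⊆SL : All (InSL D) (R₁ D)
  R₁⊆SL = SL-T 𝟘 ∷ SL-T 𝟙 ∷ SL-T (η D) ∷ SL-T (η D ⊕ 𝟙) ∷ SL-ST 𝟙 ∷ SL-ST (η D ⊕ 𝟙) ∷ []

  R₂⊆SL : All (InSL D) (R₂ D)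
  R₂⊆SL = All.++⁺ C₁⊆SL (All.++⁺ C₂⊆SL (SL-TST 𝟙 ω ∷ SL-TST 𝟙 ω̄ ∷ []))

  R₃⊆SL : All (InSL D) (R₃ D)
  R₃⊆SL = All.++⁺ C₁⊆SL (All.++⁺ C₂⊆SL (All.++⁺ C₃⊆SL C₄⊆SL))

all-Bool? : ∀ {P : Bool → Set} → (∀ b → Dec (P b)) → Dec (∀ b → P b)
all-Bool? P? = map′ (λ (f , t) → λ { false → f ; true → t }) (λ h → h false , h true)
                    (P? false ×-dec P? true)

-- 𝒪/2𝒪 = 𝔽₂[θ]/(θ² − q̂θ − p̂), where p̂ and q̂ are the residues of p D and q D, and
-- the finite objects living over it.  A hat marks the residue of an element of 𝒪.
module Mod2 (p̂ q̂ : Bool) where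

  open Formulas _xor_ _∧_ (λ b → b) p̂ q̂ public

  0̂ 1̂ ω̂ ω̂′ : Elt
  0̂ = false , false
  1̂ = true , false
  ω̂ = false , true
  ω̂′ = true , true

  Î Ŝ : Matrix
  Î = 1̂ , 0̂ , 0̂ , 1̂
  Ŝ = 0̂ , 1̂ , 1̂ , 0̂

  T̂ : Elt → Matrix
  T̂ u = 1̂ , u , 0̂ , 1̂

  InΓ̂ : Matrix → Set
  InΓ̂ (a , b , c , d) = (a ⊞ d ≡ 0̂) × (b ⊞ c ≡ 0̂)

  -- Since −1 = 1 here, the adjugate inverts matrices of determinant 1.
  SameCosetΓ̂ : Matrix → Matrix → Set
  SameCosetΓ̂ g h = InΓ̂ (Adj h ⊠ g)

  CompleteRepsΓ̂ : List Matrix → Set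
  CompleteRepsΓ̂ R̂ =
    (∀ g → Det g ≡ 1̂ → ∃[ j ] SameCosetΓ̂ g (lookup R̂ j))
    × (∀ i j → SameCosetΓ̂ (lookup R̂ i) (lookup R̂ j) → i ≡ j)

  -- Everything is finite, so CompleteRepsΓ̂ is decidable by enumeration.
  all-Elt? : ∀ {P : Elt → Set} → (∀ u → Dec (P u)) → Dec (∀ u → P u)
  all-Elt? P? = map′ (λ h (x , y) → h x y) (λ h x y → h (x , y))
                     (all-Bool? λ x → all-Bool? λ y → P? (x , y))

  all-Matrix? : ∀ {P : Matrix → Set} → (∀ g → Dec (P g)) → Dec (∀ g → P g)
  all-Matrix? P? =
    map′ (λ h (a , b , c , d) → h a b c d) (λ h a b c d → h (a , b , c , d))
         (all-Elt? λ a → all-Elt? λ b → all-Elt? λ c → all-Elt? λ d → P? (a , b , c , d))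

  _≟ᴱ_ : (u v : Elt) → Dec (u ≡ v)
  _≟ᴱ_ = ≡-dec _≟ᵇ_ _≟ᵇ_

  InΓ̂? : ∀ g → Dec (InΓ̂ g)
  InΓ̂? (a , b , c , d) = ((a ⊞ d) ≟ᴱ 0̂) ×-dec ((b ⊞ c) ≟ᴱ 0̂)

  completeRepsΓ̂? : ∀ R̂ → Dec (CompleteRepsΓ̂ R̂)
  completeRepsΓ̂? R̂ =
    all-Matrix? (λ g → (Det g ≟ᴱ 1̂) →-dec any? (λ j → InΓ̂? (Adj (lookup R̂ j) ⊠ g)))
    ×-dec all? (λ i → all? (λ j → InΓ̂? (Adj (lookup R̂ j) ⊠ lookup R̂ i) →-dec (i Fin.≟ j)))

  Ĉ₁ Ĉ₂ Ĉ₃ Ĉ₄ R̂₂ R̂₃ : List Matrix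
  Ĉ₁ = Î ∷ T̂ 1̂ ∷ T̂ ω̂ ∷ T̂ ω̂′ ∷ []
  Ĉ₂ = Ŝ ⊠ T̂ 1̂ ∷ Ŝ ⊠ T̂ ω̂ ∷ Ŝ ⊠ T̂ ω̂′ ∷ []
  Ĉ₃ = T̂ 1̂ ⊠ (Ŝ ⊠ T̂ ω̂) ∷ T̂ 1̂ ⊠ (Ŝ ⊠ T̂ ω̂′)
     ∷ T̂ ω̂ ⊠ (Ŝ ⊠ T̂ ω̂) ∷ T̂ ω̂ ⊠ (Ŝ ⊠ T̂ ω̂′)
     ∷ T̂ ω̂′ ⊠ (Ŝ ⊠ T̂ ω̂) ∷ T̂ ω̂′ ⊠ (Ŝ ⊠ T̂ ω̂′) ∷ []
  Ĉ₄ = Ŝ ⊠ (T̂ ω̂ ⊠ (Ŝ ⊠ T̂ ω̂)) ∷ Ŝ ⊠ (T̂ ω̂′ ⊠ (Ŝ ⊠ T̂ ω̂′)) ∷ []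
  R̂₂ = Ĉ₁ ++ Ĉ₂ ++ (T̂ 1̂ ⊠ (Ŝ ⊠ T̂ ω̂) ∷ T̂ 1̂ ⊠ (Ŝ ⊠ T̂ ω̂′) ∷ [])
  R̂₃ = Ĉ₁ ++ Ĉ₂ ++ Ĉ₃ ++ Ĉ₄

  R̂₁ : Elt → List Matrix
  R̂₁ η̂ = Î ∷ T̂ 1̂ ∷ T̂ η̂ ∷ T̂ (η̂ ⊞ 1̂) ∷ Ŝ ⊠ T̂ 1̂ ∷ Ŝ ⊠ T̂ (η̂ ⊞ 1̂) ∷ []

-- The finite facts, verified by evaluation, one for each ring 𝒪/2𝒪.
-- D ≡ 1 (mod 8): θ² = θ, so 𝒪/2𝒪 ≅ 𝔽₂ × 𝔽₂.
R̂₂-complete : Mod2.CompleteRepsΓ̂ false true (Mod2.R̂₂ false true)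
R̂₂-complete = from-yes (Mod2.completeRepsΓ̂? false true (Mod2.R̂₂ false true))

-- D ≡ 5 (mod 8): θ² = θ + 1, so 𝒪/2𝒪 ≅ 𝔽₄.
R̂₃-complete : Mod2.CompleteRepsΓ̂ true true (Mod2.R̂₃ true true)
R̂₃-complete = from-yes (Mod2.completeRepsΓ̂? true true (Mod2.R̂₃ true true))

-- D ≡ 2 (mod 4): θ² = 0, and η = θ.
R̂₁-complete-2mod4 : Mod2.CompleteRepsΓ̂ false false (Mod2.R̂₁ false false (false , true))
R̂₁-complete-2mod4 = from-yes (Mod2.completeRepsΓ̂? false false (Mod2.R̂₁ false false (false , true)))

-- D ≡ 3 (mod 4): θ² = 1, and η = 1 + θ.
R̂₁-complete-3mod4 : Mod2.CompleteRepsΓ̂ true false (Mod2.R̂₁ true false (true , true))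
R̂₁-complete-3mod4 = from-yes (Mod2.completeRepsΓ̂? true false (Mod2.R̂₁ true false (true , true)))

record _⇝ᴼ_ (u : 𝒪) (û : Bool × Bool) : Set where
  constructor ⟨_,_⟩ᴼ
  field
    ⇝₁ : proj₁ u ⇝ proj₁ û
    ⇝₂ : proj₂ u ⇝ proj₂ û

record _⇝ᴹ_ (g : Mat) (ĝ : (Bool × Bool) × (Bool × Bool) × (Bool × Bool) × (Bool × Bool)) : Set where
  constructor ⟨_,_,_,_⟩ᴹ
  field
    a⇝ : a g ⇝ᴼ proj₁ ĝ
    b⇝ : b g ⇝ᴼ proj₁ (proj₂ ĝ)
    c⇝ : c g ⇝ᴼ proj₁ (proj₂ (proj₂ ĝ))
    d⇝ : d g ⇝ᴼ proj₂ (proj₂ (proj₂ ĝ))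

infix 4 _⇝ᴼ_ _⇝ᴹ_

module Reduction (D : ℕ) (p̂ q̂ : Bool) (p⇝p̂ : p D ⇝ p̂) (q⇝q̂ : q D ⇝ q̂) where

  open Mod2 p̂ q̂

  ⇝ᴼ-⊕ : ∀ {u v û v̂} → u ⇝ᴼ û → v ⇝ᴼ v̂ → u ⊕ v ⇝ᴼ û ⊞ v̂
  ⇝ᴼ-⊕ ⟨ x , y ⟩ᴼ ⟨ x′ , y′ ⟩ᴼ = ⟨ ⇝-+ x x′ , ⇝-+ y y′ ⟩ᴼ

  ⇝ᴼ-⊝ : ∀ {u û} → u ⇝ᴼ û → ⊝ u ⇝ᴼ û
  ⇝ᴼ-⊝ ⟨ x , y ⟩ᴼ = ⟨ ⇝-neg x , ⇝-neg y ⟩ᴼ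

  ⇝ᴼ-· : ∀ {u v û v̂} → u ⇝ᴼ û → v ⇝ᴼ v̂ → mul D u v ⇝ᴼ û · v̂
  ⇝ᴼ-· ⟨ x , y ⟩ᴼ ⟨ x′ , y′ ⟩ᴼ =
    ⟨ ⇝-+ (⇝-* x x′) (⇝-* (⇝-* y y′) p⇝p̂) , ⇝-+ (⇝-+ (⇝-* x y′) (⇝-* y x′)) (⇝-* (⇝-* y y′) q⇝q̂) ⟩ᴼ

  ⇝ᴼ-unique : ∀ {u û v̂} → u ⇝ᴼ û → u ⇝ᴼ v̂ → û ≡ v̂
  ⇝ᴼ-unique ⟨ x , y ⟩ᴼ ⟨ x′ , y′ ⟩ᴼ = cong₂ _,_ (⇝-unique x x′) (⇝-unique y y′)

  In2𝒪⇔ : ∀ {u û} → u ⇝ᴼ û → In2𝒪 u ⇔ û ≡ 0̂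
  In2𝒪⇔ ⟨ x , y ⟩ᴼ =
    mk⇔ (λ (ex , ey) → cong₂ _,_ (⇝-unique x (Equivalence.from ⇝-even ex))
                                  (⇝-unique y (Equivalence.from ⇝-even ey)))
        (λ { refl → Equivalence.to ⇝-even x , Equivalence.to ⇝-even y })

  ⇝ᴹ-mmul : ∀ {g h ĝ ĥ} → g ⇝ᴹ ĝ → h ⇝ᴹ ĥ → mmul D g h ⇝ᴹ ĝ ⊠ ĥ
  ⇝ᴹ-mmul ⟨ a , b , c , d ⟩ᴹ ⟨ a′ , b′ , c′ , d′ ⟩ᴹ =
    ⟨ ⇝ᴼ-⊕ (⇝ᴼ-· a a′) (⇝ᴼ-· b c′) , ⇝ᴼ-⊕ (⇝ᴼ-· a b′) (⇝ᴼ-· b d′)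
    , ⇝ᴼ-⊕ (⇝ᴼ-· c a′) (⇝ᴼ-· d c′) , ⇝ᴼ-⊕ (⇝ᴼ-· c b′) (⇝ᴼ-· d d′) ⟩ᴹ

  ⇝ᴹ-minv : ∀ {g ĝ} → g ⇝ᴹ ĝ → minv g ⇝ᴹ Adj ĝ
  ⇝ᴹ-minv ⟨ a , b , c , d ⟩ᴹ = ⟨ d , ⇝ᴼ-⊝ b , ⇝ᴼ-⊝ c , a ⟩ᴹ

  ⇝ᴹ-mneg : ∀ {g ĝ} → g ⇝ᴹ ĝ → mneg g ⇝ᴹ ĝ
  ⇝ᴹ-mneg ⟨ a , b , c , d ⟩ᴹ = ⟨ ⇝ᴼ-⊝ a , ⇝ᴼ-⊝ b , ⇝ᴼ-⊝ c , ⇝ᴼ-⊝ d ⟩ᴹ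

  ⇝ᴹ-det : ∀ {g ĝ} → g ⇝ᴹ ĝ → det D g ⇝ᴼ Det ĝ
  ⇝ᴹ-det ⟨ a , b , c , d ⟩ᴹ = ⇝ᴼ-⊕ (⇝ᴼ-· a d) (⇝ᴼ-⊝ (⇝ᴼ-· b c))

  reduceᴼ : ∀ u → ∃ (u ⇝ᴼ_)
  reduceᴼ (x , y) with reduce x | reduce y
  ... | x̂ , x⇝ | ŷ , y⇝ = (x̂ , ŷ) , ⟨ x⇝ , y⇝ ⟩ᴼ

  reduceᴹ : ∀ g → ∃ (g ⇝ᴹ_)
  reduceᴹ (mat a b c d) with reduceᴼ a | reduceᴼ b | reduceᴼ c | reduceᴼ d
  ... | â , a⇝ | b̂ , b⇝ | ĉ , c⇝ | d̂ , d⇝ = (â , b̂ , ĉ , d̂) , ⟨ a⇝ , b⇝ , c⇝ , d⇝ ⟩ᴹ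

  𝟙⇝1̂ : 𝟙 ⇝ᴼ 1̂
  𝟙⇝1̂ = ⟨ ⇝-1 , ⇝-0 ⟩ᴼ

  0⇝0̂ : 𝟘 ⇝ᴼ 0̂
  0⇝0̂ = ⟨ ⇝-0 , ⇝-0 ⟩ᴼ

  det-residue : ∀ {g ĝ} → InSL D g → g ⇝ᴹ ĝ → Det ĝ ≡ 1̂
  det-residue g∈SL g⇝ = ⇝ᴼ-unique (subst (_⇝ᴼ _) g∈SL (⇝ᴹ-det g⇝)) 𝟙⇝1̂

  InM→InΓ̂ : ∀ {h ĥ} → h ⇝ᴹ ĥ → InM D h → InΓ̂ ĥ
  InM→InΓ̂ ⟨ a , b , c , d ⟩ᴹ (_ , a+d∈2𝒪 , b+c∈2𝒪) =
    Equivalence.to (In2𝒪⇔ (⇝ᴼ-⊕ a d)) a+d∈2𝒪 , Equivalence.to (In2𝒪⇔ (⇝ᴼ-⊕ b c)) b+c∈2𝒪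

  InΓ̂→InM : ∀ {h ĥ} → InSL D h → h ⇝ᴹ ĥ → InΓ̂ ĥ → InM D h
  InΓ̂→InM h∈SL ⟨ a , b , c , d ⟩ᴹ (a+d≡0 , b+c≡0) =
    h∈SL , Equivalence.from (In2𝒪⇔ (⇝ᴼ-⊕ a d)) a+d≡0 , Equivalence.from (In2𝒪⇔ (⇝ᴼ-⊕ b c)) b+c≡0

  -- Hence the coset relation is detected modulo 2; the sign ±Id disappears there.
  SameCoset→Γ̂ : ∀ {g h ĝ ĥ} → g ⇝ᴹ ĝ → h ⇝ᴹ ĥ → SameCoset D g h → SameCosetΓ̂ ĝ ĥ
  SameCoset→Γ̂ g⇝ h⇝ (inj₁ h⁻¹g∈M) = InM→InΓ̂ (⇝ᴹ-mmul (⇝ᴹ-minv h⇝) g⇝) h⁻¹g∈M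
  SameCoset→Γ̂ g⇝ h⇝ (inj₂ -h⁻¹g∈M) = InM→InΓ̂ (⇝ᴹ-mneg (⇝ᴹ-mmul (⇝ᴹ-minv h⇝) g⇝)) -h⁻¹g∈M

  Γ̂→SameCoset : ∀ {g h ĝ ĥ} → InSL D g → InSL D h → g ⇝ᴹ ĝ → h ⇝ᴹ ĥ →
                SameCosetΓ̂ ĝ ĥ → SameCoset D g h
  Γ̂→SameCoset {g} {h} g∈SL h∈SL g⇝ h⇝ =
    inj₁ ∘ InΓ̂→InM (SL-mmul D {minv h} {g} (SL-minv D {h} h∈SL) g∈SL) (⇝ᴹ-mmul (⇝ᴹ-minv h⇝) g⇝)

  -- Position i of R corresponds to position cast len i of R̂.
  lift-reps : ∀ {R R̂} → Pointwise _⇝ᴹ_ R R̂ → All (InSL D) R → CompleteRepsΓ̂ R̂ →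
              CompleteReps D R
  lift-reps {R} {R̂} R⇝R̂ R⊆SL (covers , separated) = R⊆SL , cover , separate
    where
    len : length R ≡ length R̂
    len = Pointwise-length R⇝R̂

    rep-SL : ∀ i → InSL D (lookup R i)
    rep-SL i = All.lookup R⊆SL (∈-lookup i)

    cover : ∀ g → InSL D g → ∃[ i ] SameCoset D g (lookup R i)
    cover g g∈SL = from-residue (reduceᴹ g)
      where
      from-residue : ∃ (g ⇝ᴹ_) → ∃[ i ] SameCoset D g (lookup R i)
      from-residue (ĝ , g⇝) = from-rep (covers ĝ (det-residue g∈SL g⇝))
        where
        from-rep : ∃[ j ] SameCosetΓ̂ ĝ (lookup R̂ j) → ∃[ i ] SameCoset D g (lookup R i)
        from-rep (j , g~R̂j) = i , Γ̂→SameCoset g∈SL (rep-SL i) g⇝ (lookup⁺ R⇝R̂ i) g~R̂i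
          where
          i : Fin (length R)
          i = cast (sym len) j

          g~R̂i : SameCosetΓ̂ ĝ (lookup R̂ (cast len i))
          g~R̂i = subst (λ k → SameCosetΓ̂ ĝ (lookup R̂ k)) (sym (cast-involutive len (sym len) j)) g~R̂j

    separate : ∀ i j → SameCoset D (lookup R i) (lookup R j) → i ≡ j
    separate i j Ri~Rj = begin
      i                            ≡⟨ cast-involutive (sym len) len i ⟨
      cast (sym len) (cast len i)  ≡⟨ cong (cast (sym len)) (separated (cast len i) (cast len j) R̂i~R̂j) ⟩
      cast (sym len) (cast len j)  ≡⟨ cast-involutive (sym len) len j ⟩
      j                            ∎
      where
      open ≡-Reasoning
      R̂i~R̂j : SameCosetΓ̂ (lookup R̂ (cast len i)) (lookup R̂ (cast len j))
      R̂i~R̂j = SameCoset→Γ̂ (lookup⁺ R⇝R̂ i) (lookup⁺ R⇝R̂ j) Ri~Rj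

  Id⇝ : Id ⇝ᴹ Î
  Id⇝ = ⟨ 𝟙⇝1̂ , 0⇝0̂ , 0⇝0̂ , 𝟙⇝1̂ ⟩ᴹ

  S⇝ : S ⇝ᴹ Ŝ
  S⇝ = ⟨ 0⇝0̂ , 𝟙⇝1̂ , ⇝ᴼ-⊝ 𝟙⇝1̂ , 0⇝0̂ ⟩ᴹ

  T⇝ : ∀ {u û} → u ⇝ᴼ û → T u ⇝ᴹ T̂ û
  T⇝ u⇝ = ⟨ 𝟙⇝1̂ , u⇝ , 0⇝0̂ , 𝟙⇝1̂ ⟩ᴹ

  ω⇝ : ω ⇝ᴼ ω̂
  ω⇝ = ⟨ ⇝-0 , ⇝-1 ⟩ᴼ

  ω̄⇝ : ω̄ ⇝ᴼ ω̂′
  ω̄⇝ = ⟨ ⇝-1 , ⇝-neg ⇝-1 ⟩ᴼ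

  ST⇝ : ∀ {u û} → u ⇝ᴼ û → mmul D S (T u) ⇝ᴹ Ŝ ⊠ T̂ û
  ST⇝ u⇝ = ⇝ᴹ-mmul S⇝ (T⇝ u⇝)

  TST⇝ : ∀ {u v û v̂} → u ⇝ᴼ û → v ⇝ᴼ v̂ → m3 D (T u) S (T v) ⇝ᴹ T̂ û ⊠ (Ŝ ⊠ T̂ v̂)
  TST⇝ u⇝ v⇝ = ⇝ᴹ-mmul (T⇝ u⇝) (ST⇝ v⇝)

  STST⇝ : ∀ {u û} → u ⇝ᴼ û → m4 D S (T u) S (T u) ⇝ᴹ Ŝ ⊠ (T̂ û ⊠ (Ŝ ⊠ T̂ û))
  STST⇝ u⇝ = ⇝ᴹ-mmul S⇝ (TST⇝ u⇝ u⇝)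

  C₁⇝ : Pointwise _⇝ᴹ_ C₁ Ĉ₁
  C₁⇝ = Id⇝ ∷ T⇝ 𝟙⇝1̂ ∷ T⇝ ω⇝ ∷ T⇝ ω̄⇝ ∷ []

  C₂⇝ : Pointwise _⇝ᴹ_ (C₂ D) Ĉ₂
  C₂⇝ = ST⇝ 𝟙⇝1̂ ∷ ST⇝ ω⇝ ∷ ST⇝ ω̄⇝ ∷ []

  C₃⇝ : Pointwise _⇝ᴹ_ (C₃ D) Ĉ₃
  C₃⇝ = TST⇝ 𝟙⇝1̂ ω⇝ ∷ TST⇝ 𝟙⇝1̂ ω̄⇝ ∷ TST⇝ ω⇝ ω⇝ ∷ TST⇝ ω⇝ ω̄⇝ ∷ TST⇝ ω̄⇝ ω⇝ ∷ TST⇝ ω̄⇝ ω̄⇝ ∷ []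

  C₄⇝ : Pointwise _⇝ᴹ_ (C₄ D) Ĉ₄
  C₄⇝ = STST⇝ ω⇝ ∷ STST⇝ ω̄⇝ ∷ []

  R₁⇝ : ∀ {η̂} → η D ⇝ᴼ η̂ → Pointwise _⇝ᴹ_ (R₁ D) (R̂₁ η̂)
  R₁⇝ {η̂} η⇝ = Id⇝ ∷ T⇝ 𝟙⇝1̂ ∷ T⇝ η⇝ ∷ T⇝ η+1⇝ ∷ ST⇝ 𝟙⇝1̂ ∷ ST⇝ η+1⇝ ∷ []
    where
    η+1⇝ : η D ⊕ 𝟙 ⇝ᴼ η̂ ⊞ 1̂
    η+1⇝ = ⇝ᴼ-⊕ η⇝ 𝟙⇝1̂

  R₂⇝ : Pointwise _⇝ᴹ_ (R₂ D) R̂₂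
  R₂⇝ = ++⁺ C₁⇝ (++⁺ C₂⇝ (TST⇝ 𝟙⇝1̂ ω⇝ ∷ TST⇝ 𝟙⇝1̂ ω̄⇝ ∷ []))

  R₃⇝ : Pointwise _⇝ᴹ_ (R₃ D) R̂₃
  R₃⇝ = ++⁺ C₁⇝ (++⁺ C₂⇝ (++⁺ C₃⇝ C₄⇝))

mod4-of : ∀ r m → (r ℕ.+ m ℕ.* 4) ℕ.% 4 ≡ r ℕ.% 4
mod4-of r m = [m+kn]%n≡m%n r m 4

div4-of : ∀ m → m ℕ.* 4 ℕ./ 4 ≡ m
div4-of m = m*n/n≡m m 4

p-1mod4 : ∀ m → p (1 ℕ.+ m ℕ.* 4) ≡ + m
p-1mod4 m rewrite mod4-of 1 m | div4-of m = refl

q-1mod4 : ∀ m → q (1 ℕ.+ m ℕ.* 4) ≡ + 1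
q-1mod4 m rewrite mod4-of 1 m = refl

module _ (m : ℕ) where

  p-2mod4 : p (2 ℕ.+ m ℕ.* 4) ≡ + (2 ℕ.+ m ℕ.* 4)
  p-2mod4 rewrite mod4-of 2 m = refl

  p-3mod4 : p (3 ℕ.+ m ℕ.* 4) ≡ + (3 ℕ.+ m ℕ.* 4)
  p-3mod4 rewrite mod4-of 3 m = refl

  q-2mod4 : q (2 ℕ.+ m ℕ.* 4) ≡ + 0
  q-2mod4 rewrite mod4-of 2 m = refl

  q-3mod4 : q (3 ℕ.+ m ℕ.* 4) ≡ + 0
  q-3mod4 rewrite mod4-of 3 m = refl

  η-2mod4 : η (2 ℕ.+ m ℕ.* 4) ≡ θ
  η-2mod4 rewrite mod4-of 2 m = refl

  η-3mod4 : η (3 ℕ.+ m ℕ.* 4) ≡ 𝟙 ⊕ θ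
  η-3mod4 rewrite mod4-of 3 m = refl

D-1mod8 D-5mod8 D-2mod4 D-3mod4 : ℕ → ℕ
D-1mod8 t = 1 ℕ.+ (t ℕ.* 2) ℕ.* 4
D-5mod8 t = 1 ℕ.+ (1 ℕ.+ t ℕ.* 2) ℕ.* 4
D-2mod4 m = 2 ℕ.+ m ℕ.* 4
D-3mod4 m = 3 ℕ.+ m ℕ.* 4

complete-1mod8 : ∀ t → CompleteReps (D-1mod8 t) (R₂ (D-1mod8 t))
complete-1mod8 t = lift-reps R₂⇝ (R₂⊆SL (D-1mod8 t)) R̂₂-complete
  where
  p⇝ : p (D-1mod8 t) ⇝ false
  p⇝ = subst (_⇝ false) (sym (p-1mod4 (t ℕ.* 2))) (⇝-shift 0 t ⇝-0)

  q⇝ : q (D-1mod8 t) ⇝ true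
  q⇝ = subst (_⇝ true) (sym (q-1mod4 (t ℕ.* 2))) ⇝-1

  open Reduction (D-1mod8 t) false true p⇝ q⇝

complete-5mod8 : ∀ t → CompleteReps (D-5mod8 t) (R₃ (D-5mod8 t))
complete-5mod8 t = lift-reps R₃⇝ (R₃⊆SL (D-5mod8 t)) R̂₃-complete
  where
  p⇝ : p (D-5mod8 t) ⇝ true
  p⇝ = subst (_⇝ true) (sym (p-1mod4 (1 ℕ.+ t ℕ.* 2))) (⇝-shift 1 t ⇝-1)

  q⇝ : q (D-5mod8 t) ⇝ true
  q⇝ = subst (_⇝ true) (sym (q-1mod4 (1 ℕ.+ t ℕ.* 2))) ⇝-1

  open Reduction (D-5mod8 t) true true p⇝ q⇝

complete-2mod4 : ∀ m → CompleteReps (D-2mod4 m) (R₁ (D-2mod4 m))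
complete-2mod4 m = lift-reps (R₁⇝ η⇝) (R₁⊆SL (D-2mod4 m)) R̂₁-complete-2mod4
  where
  p⇝ : p (D-2mod4 m) ⇝ false
  p⇝ = subst (_⇝ false) (sym (p-2mod4 m))
         (subst (λ k → + (2 ℕ.+ k) ⇝ false) (ℕ.*-assoc m 2 2) (⇝-shift 2 (m ℕ.* 2) ⇝-2))

  q⇝ : q (D-2mod4 m) ⇝ false
  q⇝ = subst (_⇝ false) (sym (q-2mod4 m)) ⇝-0

  open Reduction (D-2mod4 m) false false p⇝ q⇝

  η⇝ : η (D-2mod4 m) ⇝ᴼ (false , true)
  η⇝ = subst (_⇝ᴼ _) (sym (η-2mod4 m)) ω⇝

complete-3mod4 : ∀ m → CompleteReps (D-3mod4 m) (R₁ (D-3mod4 m))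
complete-3mod4 m = lift-reps (R₁⇝ η⇝) (R₁⊆SL (D-3mod4 m)) R̂₁-complete-3mod4
  where
  p⇝ : p (D-3mod4 m) ⇝ true
  p⇝ = subst (_⇝ true) (sym (p-3mod4 m))
         (subst (λ k → + (3 ℕ.+ k) ⇝ true) (ℕ.*-assoc m 2 2) (⇝-shift 3 (m ℕ.* 2) ⇝-3))

  q⇝ : q (D-3mod4 m) ⇝ false
  q⇝ = subst (_⇝ false) (sym (q-3mod4 m)) ⇝-0

  open Reduction (D-3mod4 m) true false p⇝ q⇝

  η⇝ : η (D-3mod4 m) ⇝ᴼ (true , true)
  η⇝ = subst (_⇝ᴼ _) (sym (η-3mod4 m)) ⟨ ⇝-1 , ⇝-1 ⟩ᴼ

form-1mod8 : ∀ D → 1 < D → + 8 ∣ (+ D - + 1) → ∃ λ t → D ≡ D-1mod8 t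
form-1mod8 0 () _
form-1mod8 (suc n) _ (ℕ∣.divides t n≡8t) = t , cong suc (trans n≡8t (sym (ℕ.*-assoc t 2 4)))

-- For 1 < D < 5, |D − 5| ∈ {1, 2, 3} is not divisible by 8.
form-5mod8 : ∀ D → 1 < D → + 8 ∣ (+ D - + 5) → ∃ λ t → D ≡ D-5mod8 t
form-5mod8 0 () _
form-5mod8 1 (s≤s ()) _
form-5mod8 2 _ 8∣3 with ∣⇒≤ 8∣3
... | s≤s (s≤s (s≤s ()))
form-5mod8 3 _ 8∣2 with ∣⇒≤ 8∣2
... | s≤s (s≤s ())
form-5mod8 4 _ 8∣1 with ∣⇒≤ 8∣1
... | s≤s ()
form-5mod8 (suc (suc (suc (suc (suc n))))) _ (ℕ∣.divides t n≡8t) =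
  t , cong (5 ℕ.+_) (trans n≡8t (sym (ℕ.*-assoc t 2 4)))

-- A squarefree D with 4 ∤ D − 1 is 2 or 3 modulo 4 (4 ∣ D is excluded by squarefreeness).
form-not1mod4 : ∀ D → Squarefree D → ¬ (+ 4 ∣ (+ D - + 1)) →
                ∃ λ m → D ≡ D-2mod4 m ⊎ D ≡ D-3mod4 m
form-not1mod4 D squarefree 4∤D-1 = classify (D ℕ.% 4) (m%n<n D 4) (m≡m%n+[m/n]*n D 4)
  where
  m : ℕ
  m = D ℕ./ 4

  classify : ∀ r → r < 4 → D ≡ r ℕ.+ m ℕ.* 4 → ∃ λ m → D ≡ D-2mod4 m ⊎ D ≡ D-3mod4 m
  classify 0 _ D≡4m with squarefree 2 (ℕ∣.divides m D≡4m)
  ... | ()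
  classify 1 _ D≡1+4m =
    ⊥-elim (4∤D-1 (subst (λ D → + 4 ∣ (+ D - + 1)) (sym D≡1+4m) (ℕ∣.divides m refl)))
  classify 2 _ D≡2+4m = m , inj₁ D≡2+4m
  classify 3 _ D≡3+4m = m , inj₂ D≡3+4m
  classify (suc (suc (suc (suc _)))) (s≤s (s≤s (s≤s (s≤s ())))) _

proposition2 : (D : ℕ) → Squarefree D → 1 < D →
    ((¬ (+ 4 ∣ (+ D - + 1))) → CompleteReps D (R₁ D))
    × ((+ 8 ∣ (+ D - + 1)) → CompleteReps D (R₂ D))
    × ((+ 8 ∣ (+ D - + 5)) → CompleteReps D (R₃ D))
proposition2 D squarefree 1<D = case-not1mod4 , case-1mod8 , case-5mod8
  where
  case-not1mod4 : ¬ (+ 4 ∣ (+ D - + 1)) → CompleteReps D (R₁ D)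
  case-not1mod4 h = by-shape (form-not1mod4 D squarefree h)
    where
    by-shape : (∃ λ m → D ≡ D-2mod4 m ⊎ D ≡ D-3mod4 m) → CompleteReps D (R₁ D)
    by-shape (m , inj₁ D≡) = subst (λ D → CompleteReps D (R₁ D)) (sym D≡) (complete-2mod4 m)
    by-shape (m , inj₂ D≡) = subst (λ D → CompleteReps D (R₁ D)) (sym D≡) (complete-3mod4 m)

  case-1mod8 : + 8 ∣ (+ D - + 1) → CompleteReps D (R₂ D)
  case-1mod8 h =
    let t , D≡ = form-1mod8 D 1<D h
    in subst (λ D → CompleteReps D (R₂ D)) (sym D≡) (complete-1mod8 t)

  case-5mod8 : + 8 ∣ (+ D - + 5) → CompleteReps D (R₃ D)
  case-5mod8 h =
    let t , D≡ = form-5mod8 D 1<D h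
    in subst (λ D → CompleteReps D (R₃ D)) (sym D≡) (complete-5mod8 t)
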